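{- Let $K$ be a field with discrete valuation $v$, $O=\{z\in K:v(z)\ge0\}$, and let $f:\mathbb{P}^m\to\mathbb{P}^M$ be a morphism of degree $d$ defined over $K$. Let $x,y\in K^{m+1}$ with $v(x)=v(y)=0$. If $v(x-y)\ge\|\varepsilon_f\|_\infty$, then $\varepsilon_f(x)=\varepsilon_f(y)$.
   Context: For a tuple $\Phi$ of elements or polynomials, $v(\Phi)$ is the minimum valuation of its entries/coefficients. For a lift $F=(F_0,\dots,F_M)$ of $f$ (degree-$d$ forms over $K$ without common nontrivial zero over $\overline K$), the excess valuation is $\varepsilon_f(x)=v(F(x))-d\,v(x)-v(F)$ for nonzero $x\in K^{m+1}$ (independent of the lift), and $\|\varepsilon_f\|_\infty=\sup_{x\ne0}\varepsilon_f(x)$. -}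

module Defs where

open import Level using (Level; _⊔_)
open import Data.Nat as ℕ using (ℕ; zero; suc; _∸_)
open import Data.Integer as ℤ using (ℤ; +_)
open import Data.Fin using (Fin)
open import Data.Vec as Vec using (Vec; []; _∷_)
open import Data.List as List using (List; []; _∷_; [_]; upTo; concatMap; length; _++_)
open import Data.Product using (∃; Σ; _,_)
open import Relation.Nullary using (¬_)
open import Relation.Binary.PropositionalEquality using (_≡_)
open import Algebra.Bundles using (CommutativeRing)
open import Algebra.Morphism.Structures using (module RingMorphisms)

record Field (c ℓ : Level) : Set (Level.suc (c ⊔ ℓ)) where
  field
    commutativeRing : CommutativeRing c ℓ
  open CommutativeRing commutativeRing public
  field
    1≉0     : ¬ (1# ≈ 0#)
    inverse : ∀ x → ¬ (x ≈ 0#) → ∃ λ y → (x * y) ≈ 1#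

data ℤ∞ : Set where
  fin : ℤ → ℤ∞
  ∞   : ℤ∞

infix 4 _≤∞_
data _≤∞_ : ℤ∞ → ℤ∞ → Set where
  fin≤fin : ∀ {a b} → a ℤ.≤ b → fin a ≤∞ fin b
  _≤∞∞    : ∀ a → a ≤∞ ∞

min∞ : ℤ∞ → ℤ∞ → ℤ∞
min∞ (fin a) (fin b) = fin (a ℤ.⊓ b)
min∞ (fin a) ∞       = fin a
min∞ ∞       b       = b

_+∞_ : ℤ∞ → ℤ∞ → ℤ∞
fin a +∞ fin b = fin (a ℤ.+ b)
fin a +∞ ∞     = ∞
∞     +∞ b     = ∞

-- a - b ; only ever used with b finite (b = ∞ is junk, sent to ∞)
_-∞_ : ℤ∞ → ℤ∞ → ℤ∞
fin a -∞ fin b = fin (a ℤ.- b)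
fin a -∞ ∞     = ∞
∞     -∞ b     = ∞

_·∞_ : ℕ → ℤ∞ → ℤ∞
d ·∞ fin a = fin (+ d ℤ.* a)
d ·∞ ∞     = ∞

minVec : ∀ {n} → Vec ℤ∞ n → ℤ∞
minVec = Vec.foldr _ min∞ ∞

minFin : ∀ {n} → (Fin n → ℤ∞) → ℤ∞
minFin f = minVec (Vec.tabulate f)

record DiscreteValuation {c ℓ} (K : Field c ℓ) : Set (c ⊔ ℓ) where
  open Field K
  field
    v        : Carrier → ℤ∞
    v-cong   : ∀ {x y} → x ≈ y → v x ≡ v y
    v-∞⇒0    : ∀ x → v x ≡ ∞ → x ≈ 0#
    v-0      : v 0# ≡ ∞
    v-mul    : ∀ x y → v (x * y) ≡ (v x +∞ v y)
    v-ultra  : ∀ x y → min∞ (v x) (v y) ≤∞ v (x + y)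
    v-surj   : ∀ (n : ℤ) → ∃ λ x → v x ≡ fin n

-- all exponent vectors e ∈ ℕⁿ with |e| = d, in a fixed order
monos : (n d : ℕ) → List (Vec ℕ n)
monos zero    zero    = [ [] ]
monos zero    (suc d) = []
monos (suc n) d       = concatMap (λ k → List.map (k ∷_) (monos n (d ∸ k))) (upTo (suc d))

-- a form = its coefficient vector, one coefficient per monomial of monos n d
record Form {a} (A : Set a) (n d : ℕ) : Set a where
  constructor form
  field
    coeffs : Vec A (length (monos n d))
open Form public

module RingOps {c ℓ} (R : CommutativeRing c ℓ) where
  open CommutativeRing R

  pow : Carrier → ℕ → Carrier
  pow x zero    = 1#
  pow x (suc k) = x * pow x k

  monoVal : ∀ {n} → Vec ℕ n → (Fin n → Carrier) → Carrier
  monoVal e x = Vec.foldr _ _*_ 1# (Vec.zipWith pow (Vec.tabulate x) e)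

  evalTerms : ∀ {n} → List Carrier → List (Vec ℕ n) → (Fin n → Carrier) → Carrier
  evalTerms (a ∷ as) (e ∷ es) x = (a * monoVal e x) + evalTerms as es x
  evalTerms _        _        x = 0#

  evalForm : ∀ n d → Form Carrier n d → (Fin n → Carrier) → Carrier
  evalForm n d F x = evalTerms (Vec.toList (coeffs F)) (monos n d) x

  -- Horner evaluation of the polynomial with coefficient list (low degree first)
  horner : List Carrier → Carrier → Carrier
  horner []       z = 0#
  horner (a ∷ as) z = a + (z * horner as z)

-- algebraically closed: every monic polynomial of positive degree has a root
AlgClosed : ∀ {c ℓ} → Field c ℓ → Set (c ⊔ ℓ)
AlgClosed L = ∀ (n : ℕ) (a : Vec Carrier (suc n)) →
  ∃ λ z → horner (Vec.toList a ++ [ 1# ]) z ≈ 0#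
  where open Field L
        open RingOps commutativeRing

-- A morphism P^m → P^M of degree d over K: a tuple F = (F_0,…,F_M) of
-- degree-d forms in m+1 variables with no common nontrivial zero over an
-- algebraic closure of K (quantified over all algebraically closed
-- extensions L of K, i.e. ring homomorphisms ι : K → L).

IsMorphism : ∀ {c ℓ} (K : Field c ℓ) {m M d : ℕ} →
             (Fin (suc M) → Form (Field.Carrier K) (suc m) d) → Set (Level.suc (c ⊔ ℓ))
IsMorphism {c} {ℓ} K {m} {M} {d} F =
  ∀ (L : Field c ℓ) (ι : Field.Carrier K → Field.Carrier L) →
  RingMorphisms.IsRingHomomorphism (Field.rawRing K) (Field.rawRing L) ι →
  AlgClosed L →
  ∀ (z : Fin (suc m) → Field.Carrier L) →
  (∀ j → Field._≈_ L (RingOps.evalForm (Field.commutativeRing L) (suc m) d (form (Vec.map ι (coeffs (F j)))) z) (Field.0# L)) →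
  ∀ i → Field._≈_ L (z i) (Field.0# L)

module Excess {c ℓ} {K : Field c ℓ} (V : DiscreteValuation K) where
  open Field K
  open DiscreteValuation V
  open RingOps commutativeRing

  vTuple : ∀ {n} → (Fin n → Carrier) → ℤ∞
  vTuple x = minFin (λ i → v (x i))

  vForms : ∀ {M n d} → (Fin M → Form Carrier n d) → ℤ∞
  vForms F = minFin (λ j → minVec (Vec.map v (coeffs (F j))))

  applyForms : ∀ {M n d} → (Fin M → Form Carrier n d) → (Fin n → Carrier) → (Fin M → Carrier)
  applyForms {n = n} {d} F x j = evalForm n d (F j) x

  ε : ∀ {M n d} → (Fin M → Form Carrier n d) → (Fin n → Carrier) → ℤ∞
  ε {d = d} F x = (vTuple (applyForms F x) -∞ (d ·∞ vTuple x)) -∞ vForms F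

  NonZeroTuple : ∀ {n} → (Fin n → Carrier) → Set ℓ
  NonZeroTuple x = ¬ (∀ i → x i ≈ 0#)

  _-ᵥ_ : ∀ {n} → (Fin n → Carrier) → (Fin n → Carrier) → (Fin n → Carrier)
  (x -ᵥ y) i = x i - y i

{-# OPTIONS --safe #-}
-- Put k = v(x - y). Since x and y are integral and congruent modulo k, each
-- monomial satisfies x^e ≡ y^e modulo k, so F_j(x) ≡ F_j(y) modulo v(F) + k.
-- As v(x) = 0, the hypothesis ε_f(x) ≤ k reads v(F(x)) ≤ v(F) + k, and the
-- ultrametric inequality then gives v(F(y)) ≥ v(F(x)). By symmetry
-- v(F(x)) = v(F(y)), and ε_f(x) = v(F(x)) - v(F) = ε_f(y).
module Submission where

open import Defs
open import Data.Nat using (ℕ; suc)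
open import Data.Integer using (+_)
open import Data.Fin using (Fin)
open import Relation.Binary.PropositionalEquality using (_≡_)

open import Data.Integer as ℤ using (-[1+_])
import Data.Integer.Properties as ℤ
import Data.Fin as Fin
open import Data.Nat using (zero)
open import Data.Vec as Vec using (Vec; []; _∷_)
open import Data.List using (List; []; _∷_)
open import Data.List.Relation.Unary.All as All using (All; []; _∷_)
open import Data.Empty using (⊥-elim)
open import Relation.Binary.PropositionalEquality as ≡ using (refl; cong; cong₂; subst)
open import Algebra.Bundles using (AbelianGroup)
open import Function using (_∘_)
import Algebra.Properties.Ring as RingProperties
import Algebra.Properties.AbelianGroup as AbelianGroupProperties
import Algebra.Properties.CommutativeSemigroup as CommutativeSemigroupProperties
import Relation.Binary.Reasoning.Setoid as SetoidReasoning

≤∞-refl : ∀ {a} → a ≤∞ a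
≤∞-refl {fin a} = fin≤fin ℤ.≤-refl
≤∞-refl {∞}     = ∞ ≤∞∞

≤∞-trans : ∀ {a b c} → a ≤∞ b → b ≤∞ c → a ≤∞ c
≤∞-trans         (fin≤fin p) (fin≤fin q) = fin≤fin (ℤ.≤-trans p q)
≤∞-trans {a = a} _           (_ ≤∞∞)     = a ≤∞∞

≤∞-antisym : ∀ {a b} → a ≤∞ b → b ≤∞ a → a ≡ b
≤∞-antisym (fin≤fin p) (fin≤fin q) = cong fin (ℤ.≤-antisym p q)
≤∞-antisym (_ ≤∞∞)     (_ ≤∞∞)     = refl

min∞-≤ˡ : ∀ a b → min∞ a b ≤∞ a
min∞-≤ˡ (fin a) (fin b) = fin≤fin (ℤ.i⊓j≤i a b)
min∞-≤ˡ (fin a) ∞       = ≤∞-refl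
min∞-≤ˡ ∞       b       = b ≤∞∞

min∞-≤ʳ : ∀ a b → min∞ a b ≤∞ b
min∞-≤ʳ (fin a) (fin b) = fin≤fin (ℤ.i⊓j≤j a b)
min∞-≤ʳ (fin a) ∞       = fin a ≤∞∞
min∞-≤ʳ ∞       b       = ≤∞-refl

min∞-glb : ∀ {t a b} → t ≤∞ a → t ≤∞ b → t ≤∞ min∞ a b
min∞-glb (fin≤fin p) (fin≤fin q) = fin≤fin (ℤ.⊓-glb p q)
min∞-glb (fin≤fin p) (_ ≤∞∞)     = fin≤fin p
min∞-glb (_ ≤∞∞)     q           = q

+∞-mono-≤∞ : ∀ {a a′ b b′} → a ≤∞ a′ → b ≤∞ b′ → (a +∞ b) ≤∞ (a′ +∞ b′)
+∞-mono-≤∞                 (fin≤fin p) (fin≤fin q) = fin≤fin (ℤ.+-mono-≤ p q)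
+∞-mono-≤∞ {a} {fin _} {b} _           (_ ≤∞∞)     = (a +∞ b) ≤∞∞
+∞-mono-≤∞ {a} {∞}     {b} _           _           = (a +∞ b) ≤∞∞

+∞-identityˡ : ∀ a → (fin (+ 0) +∞ a) ≡ a
+∞-identityˡ (fin a) = cong fin (ℤ.+-identityˡ a)
+∞-identityˡ ∞       = refl

x-∞[d·∞0]≡x : ∀ d a → (a -∞ (d ·∞ fin (+ 0))) ≡ a
x-∞[d·∞0]≡x d (fin a) = ≡.trans (cong (λ z → fin (a ℤ.- z)) (ℤ.*-zeroʳ (+ d))) (cong fin (ℤ.+-identityʳ a))
x-∞[d·∞0]≡x d ∞       = refl

-∞-≤⇒≤+∞ : ∀ a b {c} → (a -∞ b) ≤∞ c → a ≤∞ (b +∞ c)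
-∞-≤⇒≤+∞ a       ∞       _           = a ≤∞∞
-∞-≤⇒≤+∞ ∞       (fin b) (_ ≤∞∞)     = ∞ ≤∞∞
-∞-≤⇒≤+∞ (fin a) (fin b) (_ ≤∞∞)     = fin a ≤∞∞
-∞-≤⇒≤+∞ (fin a) (fin b) {fin c} (fin≤fin a-b≤c) = fin≤fin (begin
  a                   ≡⟨ ℤ.+-identityʳ a ⟨
  a ℤ.+ + 0           ≡⟨ cong (λ z → a ℤ.+ z) (ℤ.+-inverseˡ b) ⟨
  a ℤ.+ (ℤ.- b ℤ.+ b) ≡⟨ ℤ.+-assoc a (ℤ.- b) b ⟨
  (a ℤ.- b) ℤ.+ b     ≤⟨ ℤ.+-monoˡ-≤ b a-b≤c ⟩
  c ℤ.+ b             ≡⟨ ℤ.+-comm c b ⟩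
  b ℤ.+ c             ∎)
  where open ℤ.≤-Reasoning

fin-injective : ∀ {a b} → fin a ≡ fin b → a ≡ b
fin-injective refl = refl

a+∞a≡0⇒a≡0 : ∀ a → (a +∞ a) ≡ fin (+ 0) → a ≡ fin (+ 0)
a+∞a≡0⇒a≡0 (fin (+ 0))     _ = refl
a+∞a≡0⇒a≡0 (fin (+ suc n)) ()
a+∞a≡0⇒a≡0 (fin -[1+ n ])  ()
a+∞a≡0⇒a≡0 ∞               ()

minFin-≤ : ∀ {n} (f : Fin n → ℤ∞) i → minFin f ≤∞ f i
minFin-≤ f Fin.zero    = min∞-≤ˡ _ _
minFin-≤ f (Fin.suc i) = ≤∞-trans (min∞-≤ʳ _ _) (minFin-≤ (λ j → f (Fin.suc j)) i)

minFin-glb : ∀ {n t} (f : Fin n → ℤ∞) → (∀ i → t ≤∞ f i) → t ≤∞ minFin f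
minFin-glb {zero}  {t} f t≤f = t ≤∞∞
minFin-glb {suc n}     f t≤f = min∞-glb (t≤f Fin.zero) (minFin-glb (λ j → f (Fin.suc j)) (λ j → t≤f (Fin.suc j)))

minVec-map-≤ : ∀ {a} {A : Set a} {n} (f : A → ℤ∞) (u : Vec A n) →
               All (λ x → minVec (Vec.map f u) ≤∞ f x) (Vec.toList u)
minVec-map-≤ f []      = []
minVec-map-≤ f (x ∷ u) = min∞-≤ˡ _ _ ∷ All.map (≤∞-trans (min∞-≤ʳ _ _)) (minVec-map-≤ f u)

module _ {a ℓ} (G : AbelianGroup a ℓ) where
  open AbelianGroup G
  open AbelianGroupProperties G using (//-rightDividesˡ; ⁻¹-∙-comm)
  open CommutativeSemigroupProperties commutativeSemigroup using (interchange)
  open SetoidReasoning setoid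

  [x-y]∙[y-z]≈x-z : ∀ x y z → (x - y) ∙ (y - z) ≈ x - z
  [x-y]∙[y-z]≈x-z x y z = begin
    (x - y) ∙ (y ∙ z ⁻¹)  ≈⟨ assoc (x - y) y (z ⁻¹) ⟨
    ((x - y) ∙ y) ∙ z ⁻¹  ≈⟨ ∙-congʳ (//-rightDividesˡ y x) ⟩
    x - z                 ∎

  [x-y]∙[u-w]≈[x∙u]-[y∙w] : ∀ x y u w → (x - y) ∙ (u - w) ≈ (x ∙ u) - (y ∙ w)
  [x-y]∙[u-w]≈[x∙u]-[y∙w] x y u w = begin
    (x ∙ y ⁻¹) ∙ (u ∙ w ⁻¹)  ≈⟨ interchange x (y ⁻¹) u (w ⁻¹) ⟩
    (x ∙ u) ∙ (y ⁻¹ ∙ w ⁻¹)  ≈⟨ ∙-congˡ (⁻¹-∙-comm y w) ⟩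
    (x ∙ u) - (y ∙ w)        ∎

module Valuation {c ℓ} {K : Field c ℓ} (V : DiscreteValuation K) where
  open Field K
  open DiscreteValuation V
  open RingOps commutativeRing
  open RingProperties ring using (-1*x≈-x; -‿involutive; x[y-z]≈xy-xz)
  open AbelianGroupProperties +-abelianGroup using (⁻¹-anti-homo‿-; //-rightDividesˡ)

  v-1#≡0 : v 1# ≡ fin (+ 0)
  v-1#≡0 with v 1# | ≡.trans (v-cong (sym (*-identityˡ 1#))) (v-mul 1# 1#) | v-∞⇒0 1#
  ... | fin a | a≡a+a | _     = cong fin (RingProperties.x+x≈x⇒x≈0 ℤ.+-*-ring a (≡.sym (fin-injective a≡a+a)))
  ... | ∞     | _     | 1≈0 = ⊥-elim (1≉0 (1≈0 ≡.refl))

  v[-1#]≡0 : v (- 1#) ≡ fin (+ 0)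
  v[-1#]≡0 = a+∞a≡0⇒a≡0 (v (- 1#)) (begin
    v (- 1#) +∞ v (- 1#)  ≡⟨ v-mul (- 1#) (- 1#) ⟨
    v (- 1# * - 1#)       ≡⟨ v-cong (trans (-1*x≈-x (- 1#)) (-‿involutive 1#)) ⟩
    v 1#                  ≡⟨ v-1#≡0 ⟩
    fin (+ 0)             ∎)
    where open ≡.≡-Reasoning

  v-‿ : ∀ a → v (- a) ≡ v a
  v-‿ a = begin
    v (- a)               ≡⟨ v-cong (-1*x≈-x a) ⟨
    v (- 1# * a)          ≡⟨ v-mul (- 1#) a ⟩
    v (- 1#) +∞ v a       ≡⟨ cong (_+∞ v a) v[-1#]≡0 ⟩
    fin (+ 0) +∞ v a      ≡⟨ +∞-identityˡ (v a) ⟩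
    v a                   ∎
    where open ≡.≡-Reasoning

  infix 4 _≤v_ _≃_mod_

  _≤v_ : ℤ∞ → Carrier → Set
  t ≤v a = t ≤∞ v a

  Integral : Carrier → Set
  Integral a = fin (+ 0) ≤v a

  _≃_mod_ : Carrier → Carrier → ℤ∞ → Set
  a ≃ b mod t = t ≤v (a - b)

  ≤v-cong : ∀ {t a b} → a ≈ b → t ≤v a → t ≤v b
  ≤v-cong {t} a≈b = subst (t ≤∞_) (v-cong a≈b)

  ≤v-0# : ∀ {t} → t ≤v 0#
  ≤v-0# {t} = subst (t ≤∞_) (≡.sym v-0) (t ≤∞∞)

  ≤v-+ : ∀ {t a b} → t ≤v a → t ≤v b → t ≤v (a + b)
  ≤v-+ {a = a} {b} p q = ≤∞-trans (min∞-glb p q) (v-ultra a b)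

  ≤v-* : ∀ {s t a b} → s ≤v a → t ≤v b → (s +∞ t) ≤v (a * b)
  ≤v-* {s} {t} {a} {b} p q = subst ((s +∞ t) ≤∞_) (≡.sym (v-mul a b)) (+∞-mono-≤∞ p q)

  ≤v-‿ : ∀ {t a} → t ≤v a → t ≤v (- a)
  ≤v-‿ {t} {a} = subst (t ≤∞_) (≡.sym (v-‿ a))

  Integral-1# : Integral 1#
  Integral-1# = subst (fin (+ 0) ≤∞_) (≡.sym v-1#≡0) ≤∞-refl

  Integral-pow : ∀ {a} k → Integral a → Integral (pow a k)
  Integral-pow zero    _   = Integral-1#
  Integral-pow (suc k) ∫a = ≤v-* ∫a (Integral-pow k ∫a)

  Integral-monoVal : ∀ {n} (e : Vec ℕ n) {x : Fin n → Carrier} →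
                     (∀ i → Integral (x i)) → Integral (monoVal e x)
  Integral-monoVal []      _  = Integral-1#
  Integral-monoVal (k ∷ e) ∫x = ≤v-* (Integral-pow k (∫x Fin.zero)) (Integral-monoVal e (∫x ∘ Fin.suc))

  mod-refl : ∀ {t} a → a ≃ a mod t
  mod-refl a = ≤v-cong (sym (-‿inverseʳ a)) ≤v-0#

  mod-sym : ∀ {t a b} → a ≃ b mod t → b ≃ a mod t
  mod-sym {a = a} {b} = ≤v-cong (⁻¹-anti-homo‿- a b) ∘ ≤v-‿

  mod-trans : ∀ {t a b c} → a ≃ b mod t → b ≃ c mod t → a ≃ c mod t
  mod-trans {a = a} {b} {c} p q = ≤v-cong ([x-y]∙[y-z]≈x-z +-abelianGroup a b c) (≤v-+ p q)

  mod-resp-≈ : ∀ {t a a′ b b′} → a ≈ a′ → b ≈ b′ → a ≃ b mod t → a′ ≃ b′ mod t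
  mod-resp-≈ a≈a′ b≈b′ = ≤v-cong (+-cong a≈a′ (-‿cong b≈b′))

  mod-weaken : ∀ {s t a b} → s ≤∞ t → a ≃ b mod t → a ≃ b mod s
  mod-weaken = ≤∞-trans

  ≤v-resp-mod : ∀ {t a b} → t ≤v a → a ≃ b mod t → t ≤v b
  ≤v-resp-mod {a = a} {b} t≤a a≃b = ≤v-cong (//-rightDividesˡ a b) (≤v-+ (mod-sym a≃b) t≤a)

  +-cong-mod : ∀ {t a a′ b b′} → a ≃ a′ mod t → b ≃ b′ mod t → a + b ≃ a′ + b′ mod t
  +-cong-mod {a = a} {a′} {b} {b′} p q = ≤v-cong ([x-y]∙[u-w]≈[x∙u]-[y∙w] +-abelianGroup a a′ b b′) (≤v-+ p q)

  *-congˡ-mod : ∀ {s t a b b′} → s ≤v a → b ≃ b′ mod t → a * b ≃ a * b′ mod (s +∞ t)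
  *-congˡ-mod {a = a} {b} {b′} p q = ≤v-cong (x[y-z]≈xy-xz a b b′) (≤v-* p q)

  *-congˡ-mod-Integral : ∀ {t a b b′} → Integral a → b ≃ b′ mod t → a * b ≃ a * b′ mod t
  *-congˡ-mod-Integral {t} ∫a b≃b′ = subst (_≤∞ _) (+∞-identityˡ t) (*-congˡ-mod ∫a b≃b′)

  *-cong-mod : ∀ {t a a′ b b′} → Integral a → Integral b′ →
               a ≃ a′ mod t → b ≃ b′ mod t → a * b ≃ a′ * b′ mod t
  *-cong-mod {a = a} {a′} {b′ = b′} ∫a ∫b′ a≃a′ b≃b′ = mod-trans
    (*-congˡ-mod-Integral ∫a b≃b′)
    (mod-resp-≈ (*-comm b′ a) (*-comm b′ a′) (*-congˡ-mod-Integral ∫b′ a≃a′))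

  pow-cong-mod : ∀ {t a b} k → Integral a → Integral b → a ≃ b mod t → pow a k ≃ pow b k mod t
  pow-cong-mod zero    _  _  _   = mod-refl 1#
  pow-cong-mod (suc k) ∫a ∫b a≃b = *-cong-mod ∫a (Integral-pow k ∫b) a≃b (pow-cong-mod k ∫a ∫b a≃b)

  monoVal-cong-mod : ∀ {t n} (e : Vec ℕ n) {x y : Fin n → Carrier} →
                     (∀ i → Integral (x i)) → (∀ i → Integral (y i)) → (∀ i → x i ≃ y i mod t) →
                     monoVal e x ≃ monoVal e y mod t
  monoVal-cong-mod []      _  _  _   = mod-refl 1#
  monoVal-cong-mod (k ∷ e) ∫x ∫y x≃y = *-cong-mod
    (Integral-pow k (∫x Fin.zero)) (Integral-monoVal e (∫y ∘ Fin.suc))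
    (pow-cong-mod k (∫x Fin.zero) (∫y Fin.zero) (x≃y Fin.zero))
    (monoVal-cong-mod e (∫x ∘ Fin.suc) (∫y ∘ Fin.suc) (x≃y ∘ Fin.suc))

  evalTerms-cong-mod : ∀ {s t n} (as : List Carrier) (es : List (Vec ℕ n)) {x y : Fin n → Carrier} →
                       All (s ≤v_) as → (∀ i → Integral (x i)) → (∀ i → Integral (y i)) →
                       (∀ i → x i ≃ y i mod t) → evalTerms as es x ≃ evalTerms as es y mod (s +∞ t)
  evalTerms-cong-mod []       _        _          _  _  _   = mod-refl 0#
  evalTerms-cong-mod (_ ∷ _)  []       _          _  _  _   = mod-refl 0#
  evalTerms-cong-mod (a ∷ as) (e ∷ es) (s≤a ∷ s≤as) ∫x ∫y x≃y = +-cong-mod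
    (*-congˡ-mod s≤a (monoVal-cong-mod e ∫x ∫y x≃y))
    (evalTerms-cong-mod as es s≤as ∫x ∫y x≃y)

  open Excess V

  vTuple-≤ : ∀ {n} {x : Fin n → Carrier} i → vTuple x ≤v x i
  vTuple-≤ {x = x} = minFin-≤ (λ i → v (x i))

  vTuple≡0⇒Integral : ∀ {n} {x : Fin n → Carrier} → vTuple x ≡ fin (+ 0) → ∀ i → Integral (x i)
  vTuple≡0⇒Integral vx≡0 i = subst (_≤∞ _) vx≡0 (vTuple-≤ i)

  vTuple≡∞ : ∀ {n} {x : Fin n → Carrier} → (∀ i → x i ≈ 0#) → vTuple x ≡ ∞
  vTuple≡∞ {x = x} x≈0 = ≤∞-antisym (vTuple x ≤∞∞) (minFin-glb _ λ i → ≤v-cong (sym (x≈0 i)) ≤v-0#)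

  vTuple≡fin⇒NonZeroTuple : ∀ {n a} {x : Fin n → Carrier} → vTuple x ≡ fin a → NonZeroTuple x
  vTuple≡fin⇒NonZeroTuple vx≡fin x≈0 with ≡.trans (≡.sym vx≡fin) (vTuple≡∞ x≈0)
  ... | ()

  vForms-≤-coeffs : ∀ {M n d} (F : Fin M → Form Carrier n d) j → All (vForms F ≤v_) (Vec.toList (coeffs (F j)))
  vForms-≤-coeffs F j = All.map (≤∞-trans (minFin-≤ _ j)) (minVec-map-≤ v (coeffs (F j)))

  applyForms-cong-mod : ∀ {t M n d} (F : Fin M → Form Carrier n d) {x y : Fin n → Carrier} →
                        (∀ i → Integral (x i)) → (∀ i → Integral (y i)) → (∀ i → x i ≃ y i mod t) →
                        ∀ j → applyForms F x j ≃ applyForms F y j mod (vForms F +∞ t)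
  applyForms-cong-mod {n = n} {d} F ∫x ∫y x≃y j =
    evalTerms-cong-mod (Vec.toList (coeffs (F j))) (monos n d) (vForms-≤-coeffs F j) ∫x ∫y x≃y

  vTuple-applyForms-≤-mod : ∀ {t M n d} (F : Fin M → Form Carrier n d) {x y : Fin n → Carrier} →
                            (∀ i → Integral (x i)) → (∀ i → Integral (y i)) → (∀ i → x i ≃ y i mod t) →
                            vTuple (applyForms F x) ≤∞ (vForms F +∞ t) →
                            vTuple (applyForms F x) ≤∞ vTuple (applyForms F y)
  vTuple-applyForms-≤-mod F ∫x ∫y x≃y vFx≤vF+t = minFin-glb _ λ j →
    ≤v-resp-mod (vTuple-≤ j) (mod-weaken vFx≤vF+t (applyForms-cong-mod F ∫x ∫y x≃y j))

  ε≤⇒vTuple-applyForms-≤ : ∀ {t M n d} (F : Fin M → Form Carrier n d) {x : Fin n → Carrier} →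
                           vTuple x ≡ fin (+ 0) → ε F x ≤∞ t →
                           vTuple (applyForms F x) ≤∞ (vForms F +∞ t)
  ε≤⇒vTuple-applyForms-≤ {t} {d = d} F {x} vx≡0 εx≤t =
    -∞-≤⇒≤+∞ vFx (vForms F) (subst (λ a → (a -∞ vForms F) ≤∞ t) vFx-d·vx≡vFx εx≤t)
    where
    vFx = vTuple (applyForms F x)
    vFx-d·vx≡vFx : (vFx -∞ (d ·∞ vTuple x)) ≡ vFx
    vFx-d·vx≡vFx = ≡.trans (cong (λ w → vFx -∞ (d ·∞ w)) vx≡0) (x-∞[d·∞0]≡x d vFx)

proposition5p4 : ∀ {c ℓ} (K : Field c ℓ) (V : DiscreteValuation K) (m M d : ℕ)
    (F : Fin (suc M) → Form (Field.Carrier K) (suc m) d) →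
    IsMorphism K F →
    (x y : Fin (suc m) → Field.Carrier K) →
    Excess.vTuple V x ≡ fin (+ 0) →
    Excess.vTuple V y ≡ fin (+ 0) →
    (∀ (z : Fin (suc m) → Field.Carrier K) → Excess.NonZeroTuple V z →
      Excess.ε V F z ≤∞ Excess.vTuple V (Excess._-ᵥ_ V x y)) →
    Excess.ε V F x ≡ Excess.ε V F y
proposition5p4 K V m M d F _ x y vx≡0 vy≡0 ε≤v[x-y] =
  cong₂ (λ a w → (a -∞ (d ·∞ w)) -∞ vForms F) vFx≡vFy (≡.trans vx≡0 (≡.sym vy≡0))
  where
  open Valuation V
  open Excess V
  ∫x : ∀ i → Integral (x i)
  ∫x = vTuple≡0⇒Integral vx≡0
  ∫y : ∀ i → Integral (y i)
  ∫y = vTuple≡0⇒Integral vy≡0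
  x≃y : ∀ i → x i ≃ y i mod vTuple (x -ᵥ y)
  x≃y = vTuple-≤
  vFx≡vFy : vTuple (applyForms F x) ≡ vTuple (applyForms F y)
  vFx≡vFy = ≤∞-antisym
    (vTuple-applyForms-≤-mod F ∫x ∫y x≃y
      (ε≤⇒vTuple-applyForms-≤ F vx≡0 (ε≤v[x-y] x (vTuple≡fin⇒NonZeroTuple vx≡0))))
    (vTuple-applyForms-≤-mod F ∫y ∫x (mod-sym ∘ x≃y)
      (ε≤⇒vTuple-applyForms-≤ F vy≡0 (ε≤v[x-y] y (vTuple≡fin⇒NonZeroTuple vy≡0))))
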